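{- Let $G$ be a graph and $\epsilon\in(0,1]$. There exists a positive integer $k$ such that $G$ is $(k,\epsilon)$-flexible if and only if $\epsilon\le 1/\rho(G)$.
   Context: All graphs are finite, simple and nonempty. The Hall ratio of $G$ is $\rho(G)=\max_{H} |V(H)|/\alpha(H)$, the maximum over all nonempty subgraphs $H$ of $G$, where $\alpha$ is the independence number. A list assignment $L$ for $G$ assigns to each vertex $v$ a set $L(v)$ of colors; it is a $k$-assignment if $|L(v)|=k$ for all $v$. A proper $L$-coloring is a function $f$ on $V(G)$ with $f(v)\in L(v)$ for all $v$ and $f(u)\neq f(v)$ whenever $uv\in E(G)$. A request of $L$ is a function $r$ with non-empty domain $D\subseteq V(G)$ such that $r(v)\in L(v)$ for each $v\in D$. $(G,L,r)$ is $\epsilon$-satisfiable if there is a proper $L$-coloring $f$ of $G$ with $f(v)=r(v)$ for at least $\epsilon|D|$ vertices $v\in D$. $G$ is $(k,\epsilon)$-flexible if $(G,L,r)$ is $\epsilon$-satisfiable for every $k$-assignment $L$ and every request $r$ of $L$.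
   Formalization: The parameter ε ranges over the rationals in the interval (0,1]. -}

module Defs where

open import Data.Nat as ℕ using (ℕ; suc)
open import Data.Integer using (+_)
open import Data.Rational using (ℚ; _/_; _≤_; _*_; 0ℚ; 1ℚ; _<_)
open import Data.Fin using (Fin)
open import Data.Fin.Subset using (Subset; _∈_; _∉_; _⊆_; ∣_∣; Nonempty)
open import Data.Bool using (Bool; true; false)
open import Data.List using (List; length)
open import Data.List.Relation.Unary.Unique.Propositional using (Unique)
import Data.List.Membership.Propositional as LM
open import Data.Product using (Σ; ∃; _×_; _,_)
open import Relation.Binary.PropositionalEquality using (_≡_; _≢_)

toℚ : ℕ → ℚ
toℚ n = (+ n) / 1

record Graph : Set where
  field
    n      : ℕ
    E      : Fin n → Fin n → Bool
    sym    : ∀ u v → E u v ≡ E v u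
    irrefl : ∀ v → E v v ≡ false
    nonempty : 1 ℕ.≤ n
open Graph public

-- A (not necessarily induced) subgraph H of G: vertex set S, edge set F ⊆ E(G)
-- with both endpoints of each edge in S.
record Subgraph (G : Graph) : Set where
  field
    S     : Subset (n G)
    F     : Fin (n G) → Fin (n G) → Bool
    F-sym : ∀ u v → F u v ≡ F v u
    F-sub : ∀ u v → F u v ≡ true → (E G u v ≡ true) × (u ∈ S) × (v ∈ S)
open Subgraph public

IsIndependent : {G : Graph} → Subgraph G → Subset (n G) → Set
IsIndependent H I = (I ⊆ S H) × (∀ u v → u ∈ I → v ∈ I → F H u v ≡ false)

IsIndependenceNumber : {G : Graph} → Subgraph G → ℕ → Set
IsIndependenceNumber H a =
  (Σ (Subset _) λ I → IsIndependent H I × ∣ I ∣ ≡ a)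
  × (∀ I → IsIndependent H I → ∣ I ∣ ℕ.≤ a)

-- |V(H)| / α(H) as a rational (0 if α(H) = 0, which never happens for nonempty H)
ratio : ℕ → ℕ → ℚ
ratio v ℕ.zero = 0ℚ
ratio v (suc a) = (+ v) / suc a

IsHallRatio : Graph → ℚ → Set
IsHallRatio G ρ =
  (Σ (Subgraph G) λ H → Nonempty (S H) × Σ ℕ λ a → IsIndependenceNumber H a × ρ ≡ ratio ∣ S H ∣ a)
  × (∀ (H : Subgraph G) → Nonempty (S H) → ∀ a → IsIndependenceNumber H a → ratio ∣ S H ∣ a ≤ ρ)

-- Colors are natural numbers. A k-assignment: each list has k distinct colors.
IsKAssignment : (G : Graph) → ℕ → (Fin (n G) → List ℕ) → Set
IsKAssignment G k L = ∀ v → Unique (L v) × length (L v) ≡ k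

-- A request of L: nonempty domain D and r v ∈ L v for v ∈ D
-- (values of r outside D are irrelevant).
IsRequest : (G : Graph) → (Fin (n G) → List ℕ) → Subset (n G) → (Fin (n G) → ℕ) → Set
IsRequest G L D r = Nonempty D × (∀ v → v ∈ D → r v LM.∈ L v)

IsProperLColoring : (G : Graph) → (Fin (n G) → List ℕ) → (Fin (n G) → ℕ) → Set
IsProperLColoring G L f = (∀ v → f v LM.∈ L v) × (∀ u v → E G u v ≡ true → f u ≢ f v)

EpsSatisfiable : (G : Graph) → (Fin (n G) → List ℕ) → Subset (n G) → (Fin (n G) → ℕ) → ℚ → Set
EpsSatisfiable G L D r ε =
  Σ (Fin (n G) → ℕ) λ f → IsProperLColoring G L f ×
    Σ (Subset (n G)) λ A → (A ⊆ D) × (∀ v → v ∈ A → f v ≡ r v) × (ε * toℚ ∣ D ∣ ≤ toℚ ∣ A ∣)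

Flexible : Graph → ℕ → ℚ → Set
Flexible G k ε = ∀ L → IsKAssignment G k L → ∀ D r → IsRequest G L D r → EpsSatisfiable G L D r ε

-- Necessity: give every vertex the same list and request the same colour on
-- the vertex set of a subgraph H; the satisfied requests form one colour class,
-- hence an independent set of H, so ε |V(H)| ≤ α(H) for every H, i.e. ε ≤ 1/ρ.
-- Sufficiency, with k = 2|V(G)|: for a request on D, honour it on a maximum
-- independent set I of G[D], which has at least |D|/ρ ≥ ε|D| vertices, and
-- give all other vertices pairwise distinct colours avoiding every requested
-- colour; lists of size 2|V(G)| leave room for this greedy choice.
module Submission where

open import Defs
open import Data.Nat as ℕ using (ℕ; suc; zero)
import Data.Nat.Properties as ℕP
open import Data.Fin as Fin using (Fin)
import Data.Fin.Properties as FinP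
open import Data.Fin.Subset as Sub using (Subset; ⁅_⁆; ∣_∣; Nonempty)
import Data.Fin.Subset.Properties as SubP
open import Data.List using (List; _∷_; length; filter; tabulate; upTo)
import Data.List.Properties as ListP
open import Data.List.Relation.Unary.Unique.Propositional using (Unique; _∷_)
import Data.List.Relation.Unary.Unique.Propositional.Properties as UniqueP
import Data.List.Relation.Unary.All as All
open import Data.List.Relation.Unary.Any as Any using (here; there)
open import Data.List.Membership.Propositional using (_∈_; _∉_)
import Data.List.Membership.Propositional.Properties as ∈P
import Data.List.Membership.DecPropositional as DecMembership
open import Data.Product using (Σ; ∃; _×_; _,_; proj₁; proj₂)
open import Data.Bool using (true; false; _∧_)
import Data.Bool.Properties as BoolP
open import Data.Vec using (lookup)
import Data.Vec.Properties as VecP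
open import Data.Integer as ℤ using (+_)
import Data.Integer.Properties as ℤP
open import Data.Rational
  using (ℚ; _≤_; _<_; 0ℚ; 1ℚ; 1/_; _*_; NonZero; Positive; NonNegative; toℚᵘ; positive)
open import Data.Rational.Properties
import Data.Rational.Unnormalised as ℚᵘ
import Data.Rational.Unnormalised.Properties as ℚᵘP
open import Relation.Nullary using (yes; no; ¬?; contradiction)
open import Relation.Nullary.Decidable using (_×-dec_; _→-dec_)
open import Relation.Unary using (Pred; Decidable)
open import Relation.Binary.Definitions using (DecidableEquality)
open import Relation.Binary.PropositionalEquality
  using (_≡_; _≢_; refl; cong; cong₂; subst; subst₂)
  renaming (sym to ≡-sym; trans to ≡-trans)
open import Function.Bundles using (_⇔_; mk⇔; Equivalence)
open import Level using (Level)

private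
  variable
    ℓ : Level

module _ {A : Set ℓ} (_≟_ : DecidableEquality A) where

  open DecMembership _≟_ using (_∈?_)

  ∃∈∉-longer-unique : ∀ {xs ys : List A} → Unique xs → length ys ℕ.< length xs →
                      ∃ λ x → x ∈ xs × x ∉ ys
  ∃∈∉-longer-unique {x ∷ xs} {ys} (x≢xs ∷ xs!) ys<x∷xs with x ∈? ys
  ... | no x∉ys = x , here refl , x∉ys
  ... | yes x∈ys
    with z , z∈xs , z∉ys⁻ ← ∃∈∉-longer-unique {xs} {filter (λ y → ¬? (x ≟ y)) ys} xs!
           (ℕP.<-≤-trans (ListP.filter-notAll _ ys (Any.map (λ x≡y x≢y → x≢y x≡y) x∈ys))
                         (ℕP.≤-pred ys<x∷xs))
    = z , there z∈xs , λ z∈ys → z∉ys⁻ (∈P.∈-filter⁺ _ z∈ys (All.lookup x≢xs z∈xs))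

  injective-choice-avoiding : (m : ℕ) (L : Fin m → List A) (forbidden : List A) →
    (∀ v → Unique (L v)) → (∀ v → length forbidden ℕ.+ m ℕ.≤ length (L v)) →
    Σ (Fin m → A) λ g → (∀ v → g v ∈ L v) × (∀ v → g v ∉ forbidden) ×
                        (∀ u v → u ≢ v → g u ≢ g v)
  injective-choice-avoiding zero L forbidden _ _ = (λ ()) , (λ ()) , (λ ()) , λ ()
  injective-choice-avoiding (suc m) L forbidden L! room
    with c , c∈L₀ , c∉forbidden ← ∃∈∉-longer-unique (L! Fin.zero)
           (ℕP.<-≤-trans (ℕP.m<m+n (length forbidden) ℕ.z<s) (room Fin.zero))
    with g , g∈L , g∉c∷forbidden , g-inj ←
           injective-choice-avoiding m (λ v → L (Fin.suc v)) (c ∷ forbidden) (λ v → L! (Fin.suc v))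
           (λ v → subst (ℕ._≤ length (L (Fin.suc v))) (ℕP.+-suc (length forbidden) m) (room (Fin.suc v)))
    = h , h∈L , h∉forbidden , h-inj
    where
    h : Fin (suc m) → A
    h Fin.zero    = c
    h (Fin.suc v) = g v
    h∈L : ∀ v → h v ∈ L v
    h∈L Fin.zero    = c∈L₀
    h∈L (Fin.suc v) = g∈L v
    h∉forbidden : ∀ v → h v ∉ forbidden
    h∉forbidden Fin.zero      = c∉forbidden
    h∉forbidden (Fin.suc v) p = g∉c∷forbidden v (there p)
    h-inj : ∀ u v → u ≢ v → h u ≢ h v
    h-inj Fin.zero    Fin.zero    0≢0 _  = 0≢0 refl
    h-inj Fin.zero    (Fin.suc v) _   eq = g∉c∷forbidden v (here (≡-sym eq))
    h-inj (Fin.suc u) Fin.zero    _   eq = g∉c∷forbidden u (here eq)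
    h-inj (Fin.suc u) (Fin.suc v) u≢v eq = g-inj u v (λ u≡v → u≢v (cong Fin.suc u≡v)) eq

IsMaximumSize : ∀ {n} → Pred (Subset n) ℓ → ℕ → Set ℓ
IsMaximumSize P a = (Σ (Subset _) λ I → P I × ∣ I ∣ ≡ a) × (∀ I → P I → ∣ I ∣ ℕ.≤ a)

∃-maximum-size : ∀ {n} {P : Pred (Subset n) ℓ} → Decidable P → ∀ {I₀} → P I₀ →
                 ∃ (IsMaximumSize P)
∃-maximum-size {n = n} {P} P? {I₀} PI₀ = search n (λ I _ → SubP.∣p∣≤n I)
  where
  search : ∀ b → (∀ I → P I → ∣ I ∣ ℕ.≤ b) → ∃ (IsMaximumSize P)
  search zero ≤0 = zero , (I₀ , PI₀ , ℕP.n≤0⇒n≡0 (≤0 I₀ PI₀)) , ≤0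
  search (suc b) ≤1+b with SubP.anySubset? (λ I → P? I ×-dec (∣ I ∣ ℕ.≟ suc b))
  ... | yes attained = suc b , attained , ≤1+b
  ... | no unattained = search b λ I PI →
          ℕP.≤-pred (ℕP.≤∧≢⇒< (≤1+b I PI) (λ eq → unattained (I , PI , eq)))

toℚ-mono : ∀ {m n} → m ℕ.≤ n → toℚ m ≤ toℚ n
toℚ-mono {m} {n} m≤n = toℚᵘ-cancel-≤ (begin
  toℚᵘ (toℚ m)    ≃⟨ toℚᵘ-fromℚᵘ (ℚᵘ.mkℚᵘ (+ m) 0) ⟩
  ℚᵘ.mkℚᵘ (+ m) 0 ≤⟨ ℚᵘ.*≤* (ℤP.*-monoʳ-≤-nonNeg (+ 1) (ℤ.+≤+ m≤n)) ⟩
  ℚᵘ.mkℚᵘ (+ n) 0 ≃⟨ toℚᵘ-fromℚᵘ (ℚᵘ.mkℚᵘ (+ n) 0) ⟨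
  toℚᵘ (toℚ n)    ∎)
  where open ℚᵘP.≤-Reasoning

toℚ-pos : ∀ a → Positive (toℚ (suc a))
toℚ-pos a = normalize-pos (suc a) 1

ratio-*-toℚ : ∀ d a → ratio d (suc a) * toℚ (suc a) ≡ toℚ d
ratio-*-toℚ d a = toℚᵘ-injective (begin
  toℚᵘ (ratio d (suc a) * toℚ (suc a))
    ≈⟨ toℚᵘ-homo-* (ratio d (suc a)) (toℚ (suc a)) ⟩
  toℚᵘ (ratio d (suc a)) ℚᵘ.* toℚᵘ (toℚ (suc a))
    ≈⟨ ℚᵘP.*-cong (toℚᵘ-fromℚᵘ (ℚᵘ.mkℚᵘ (+ d) a)) (toℚᵘ-fromℚᵘ (ℚᵘ.mkℚᵘ (+ suc a) 0)) ⟩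
  ℚᵘ.mkℚᵘ (+ d) a ℚᵘ.* ℚᵘ.mkℚᵘ (+ suc a) 0
    ≈⟨ ℚᵘ.*≡* cross ⟩
  ℚᵘ.mkℚᵘ (+ d) 0
    ≈⟨ toℚᵘ-fromℚᵘ (ℚᵘ.mkℚᵘ (+ d) 0) ⟨
  toℚᵘ (toℚ d) ∎)
  where
  open ℚᵘP.≃-Reasoning
  cross : (+ d ℤ.* + suc a) ℤ.* + 1 ≡ + d ℤ.* + (suc a ℕ.* 1)
  cross = ≡-trans (ℤP.*-identityʳ _) (cong (λ x → + d ℤ.* + x) (≡-sym (ℕP.*-identityʳ (suc a))))

ratio-nonNeg : ∀ d a → NonNegative (ratio d a)
ratio-nonNeg d zero    = _
ratio-nonNeg d (suc a) = normalize-nonNeg d (suc a)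

*-ratio≤1⇔*-size≤ : ∀ ε d a → 1 ℕ.≤ a → (ε * ratio d a ≤ 1ℚ) ⇔ (ε * toℚ d ≤ toℚ a)
*-ratio≤1⇔*-size≤ ε d (suc a) _ = mk⇔
  (λ h → subst₂ _≤_ ε*ratio*size≡ε*d (*-identityˡ _) (*-monoʳ-≤-nonNeg size h))
  (λ h → *-cancelʳ-≤-pos size (subst₂ _≤_ (≡-sym ε*ratio*size≡ε*d) (≡-sym (*-identityˡ _)) h))
  where
  size : ℚ
  size = toℚ (suc a)
  instance
    size>0 : Positive size
    size>0 = toℚ-pos a
    size≥0 : NonNegative size
    size≥0 = pos⇒nonNeg size
  ε*ratio*size≡ε*d : ε * ratio d (suc a) * size ≡ ε * toℚ d
  ε*ratio*size≡ε*d = ≡-trans (*-assoc ε _ _) (cong (ε *_) (ratio-*-toℚ d a))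

≤1/⇔*≤1 : ∀ ε ρ .{{_ : NonZero ρ}} .{{_ : Positive ρ}} → (ε ≤ 1/ ρ) ⇔ (ε * ρ ≤ 1ℚ)
≤1/⇔*≤1 ε ρ = mk⇔
  (λ h → subst (ε * ρ ≤_) (*-inverseˡ ρ) (*-monoʳ-≤-nonNeg ρ {{pos⇒nonNeg ρ}} h))
  (λ h → *-cancelʳ-≤-pos ρ (subst (ε * ρ ≤_) (≡-sym (*-inverseˡ ρ)) h))

∧≡true : ∀ {x y} → x ∧ y ≡ true → (x ≡ true) × (y ≡ true)
∧≡true {true} eq = refl , eq

module _ (G : Graph) where

  adjacent⇒≢ : ∀ {u v} → E G u v ≡ true → u ≢ v
  adjacent⇒≢ {u} uv refl with () ← ≡-trans (≡-sym uv) (irrefl G u)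

  induced : Subset (n G) → Subgraph G
  induced D = record
    { S     = D
    ; F     = λ u v → E G u v ∧ (lookup D u ∧ lookup D v)
    ; F-sym = λ u v → cong₂ _∧_ (Graph.sym G u v) (BoolP.∧-comm (lookup D u) (lookup D v))
    ; F-sub = λ u v uv∧Du∧Dv →
        let (uv , Du∧Dv) = ∧≡true uv∧Du∧Dv ; (Du , Dv) = ∧≡true Du∧Dv
        in uv , VecP.lookup⇒[]= u D Du , VecP.lookup⇒[]= v D Dv
    }

  independent-in-induced⇒edgeless : ∀ {D I} → IsIndependent (induced D) I →
    ∀ u v → u Sub.∈ I → v Sub.∈ I → E G u v ≡ false
  independent-in-induced⇒edgeless {D} (I⊆D , indep) u v u∈I v∈I
    with E G u v | indep u v u∈I v∈I
  ... | false | _ = refl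
  ... | true  | Du∧Dv≡false
    with () ← ≡-trans (≡-sym (cong₂ _∧_ (VecP.[]=⇒lookup (I⊆D u∈I)) (VecP.[]=⇒lookup (I⊆D v∈I))))
                      Du∧Dv≡false

  module _ (H : Subgraph G) where

    isIndependent? : Decidable (IsIndependent H)
    isIndependent? I = (I SubP.⊆? S H) ×-dec
      FinP.all? λ u → FinP.all? λ v →
        (u SubP.∈? I) →-dec ((v SubP.∈? I) →-dec (F H u v BoolP.≟ false))

    ∃-independenceNumber : ∃ (IsIndependenceNumber H)
    ∃-independenceNumber = ∃-maximum-size isIndependent? {Sub.⊥}
      ((λ x∈⊥ → contradiction x∈⊥ SubP.∉⊥) , λ u _ u∈⊥ → contradiction u∈⊥ SubP.∉⊥)

    F-irrefl : ∀ v → F H v v ≡ false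
    F-irrefl v with F H v v in vv
    ... | false = refl
    ... | true  = contradiction refl (adjacent⇒≢ (proj₁ (F-sub H v v vv)))

    ⁅⁆-independent : ∀ {d} → d Sub.∈ S H → IsIndependent H ⁅ d ⁆
    ⁅⁆-independent {d} d∈S = ⁅d⁆⊆S , ⁅d⁆-indep
      where
      ⁅d⁆⊆S : ⁅ d ⁆ Sub.⊆ S H
      ⁅d⁆⊆S x∈⁅d⁆ rewrite SubP.x∈⁅y⁆⇒x≡y d x∈⁅d⁆ = d∈S
      ⁅d⁆-indep : ∀ u v → u Sub.∈ ⁅ d ⁆ → v Sub.∈ ⁅ d ⁆ → F H u v ≡ false
      ⁅d⁆-indep u v u∈ v∈ rewrite SubP.x∈⁅y⁆⇒x≡y d u∈ | SubP.x∈⁅y⁆⇒x≡y d v∈ = F-irrefl d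

    independenceNumber-positive : Nonempty (S H) → ∀ {a} → IsIndependenceNumber H a → 1 ℕ.≤ a
    independenceNumber-positive (d , d∈S) (_ , maximum) =
      subst (ℕ._≤ _) (SubP.∣⁅x⁆∣≡1 d) (maximum ⁅ d ⁆ (⁅⁆-independent d∈S))

    colour-class-independent : ∀ {L f} → IsProperLColoring G L f → ∀ {A c} →
      A Sub.⊆ S H → (∀ v → v Sub.∈ A → f v ≡ c) → IsIndependent H A
    colour-class-independent (_ , proper) {A} A⊆S f≡c = A⊆S , λ u v u∈A v∈A → no-edge u v u∈A v∈A
      where
      no-edge : ∀ u v → u Sub.∈ A → v Sub.∈ A → F H u v ≡ false
      no-edge u v u∈A v∈A with F H u v in uv
      ... | false = refl
      ... | true  = contradiction (≡-trans (f≡c u u∈A) (≡-sym (f≡c v v∈A)))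
                                  (proper u v (proj₁ (F-sub H u v uv)))

  colouring-honouring-request : ∀ (L : Fin (n G) → List ℕ) (r : Fin (n G) → ℕ) {I} →
    (∀ v → Unique (L v)) → (∀ v → n G ℕ.+ n G ℕ.≤ length (L v)) →
    (∀ v → v Sub.∈ I → r v ∈ L v) → (∀ u v → u Sub.∈ I → v Sub.∈ I → E G u v ≡ false) →
    Σ (Fin (n G) → ℕ) λ f → IsProperLColoring G L f × (∀ v → v Sub.∈ I → f v ≡ r v)
  colouring-honouring-request L r {I} L! room r∈L I-edgeless
    with g , g∈L , g-unrequested , g-inj ← injective-choice-avoiding ℕ._≟_ (n G) L (tabulate r) L!
           (λ v → subst (λ m → m ℕ.+ n G ℕ.≤ length (L v)) (≡-sym (ListP.length-tabulate r)) (room v))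
    = f , (f∈L , proper) , honoured
    where
    f : Fin (n G) → ℕ
    f v with v SubP.∈? I
    ... | yes _ = r v
    ... | no  _ = g v
    f∈L : ∀ v → f v ∈ L v
    f∈L v with v SubP.∈? I
    ... | yes v∈I = r∈L v v∈I
    ... | no  _   = g∈L v
    honoured : ∀ v → v Sub.∈ I → f v ≡ r v
    honoured v v∈I with v SubP.∈? I
    ... | yes _   = refl
    ... | no  v∉I = contradiction v∈I v∉I
    proper : ∀ u v → E G u v ≡ true → f u ≢ f v
    proper u v uv with u SubP.∈? I | v SubP.∈? I
    ... | yes u∈I | yes v∈I = λ _ → contradiction (≡-trans (≡-sym uv) (I-edgeless u v u∈I v∈I)) λ ()
    ... | yes _   | no  _   = λ ru≡gv → g-unrequested v (subst (_∈ tabulate r) ru≡gv (∈P.∈-tabulate⁺ u))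
    ... | no  _   | yes _   = λ gu≡rv → g-unrequested u (subst (_∈ tabulate r) (≡-sym gu≡rv) (∈P.∈-tabulate⁺ v))
    ... | no  _   | no  _   = g-inj u v (adjacent⇒≢ uv)

  flexible⇒size-bound : ∀ {k ε} → 1 ℕ.≤ k → Flexible G k ε →
    (H : Subgraph G) → Nonempty (S H) → ∀ {a} → IsIndependenceNumber H a →
    ε * toℚ ∣ S H ∣ ≤ toℚ a
  flexible⇒size-bound {k} 1≤k flexible H S≠∅ (_ , maximum)
    with f , f-proper , A , A⊆S , f≡0 , ε∣S∣≤∣A∣ ← flexible (λ _ → upTo k)
           (λ _ → UniqueP.upTo⁺ k , ListP.length-upTo k) (S H) (λ _ → 0)
           (S≠∅ , λ _ _ → ∈P.∈-upTo⁺ 1≤k)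
    = ≤-trans ε∣S∣≤∣A∣ (toℚ-mono (maximum A (colour-class-independent H f-proper A⊆S f≡0)))

  size-bound⇒flexible : ∀ {ε} →
    (∀ D → Nonempty D → ∀ {a} → IsIndependenceNumber (induced D) a → ε * toℚ ∣ D ∣ ≤ toℚ a) →
    Flexible G (n G ℕ.+ n G) ε
  size-bound⇒flexible {ε} bound L L-assignment D r (D≠∅ , r∈L)
    with a , (I , I-indep@(I⊆D , _) , ∣I∣≡a) , maximum ← ∃-independenceNumber (induced D)
    with f , f-proper , f≡r ← colouring-honouring-request L r
           (λ v → proj₁ (L-assignment v)) (λ v → ℕP.≤-reflexive (≡-sym (proj₂ (L-assignment v))))
           (λ v v∈I → r∈L v (I⊆D v∈I)) (independent-in-induced⇒edgeless I-indep)
    = f , f-proper , I , I⊆D , f≡r ,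
      subst (λ m → ε * toℚ ∣ D ∣ ≤ toℚ m) (≡-sym ∣I∣≡a)
            (bound D D≠∅ ((I , I-indep , ∣I∣≡a) , maximum))

proposition3 : (G : Graph) (ε : ℚ) → 0ℚ < ε → ε ≤ 1ℚ →
    (ρ : ℚ) → IsHallRatio G ρ → .{{_ : NonZero ρ}} →
    ((Σ ℕ λ k → (1 ℕ.≤ k) × Flexible G k ε) ⇔ (ε ≤ 1/ ρ))
proposition3 G ε 0<ε _ ρ ((H , S≠∅ , a , α , ρ≡ratio) , ratio≤ρ) = mk⇔ necessary sufficient
  where
  instance
    ρ>0 : Positive ρ
    ρ>0 = nonNeg∧nonZero⇒pos ρ {{subst NonNegative (≡-sym ρ≡ratio) (ratio-nonNeg _ a)}}
    ε≥0 : NonNegative ε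
    ε≥0 = pos⇒nonNeg ε {{positive 0<ε}}

  necessary : (Σ ℕ λ k → (1 ℕ.≤ k) × Flexible G k ε) → ε ≤ 1/ ρ
  necessary (k , 1≤k , flexible) = Equivalence.from (≤1/⇔*≤1 ε ρ)
    (subst (λ x → ε * x ≤ 1ℚ) (≡-sym ρ≡ratio)
      (Equivalence.from (*-ratio≤1⇔*-size≤ ε _ a (independenceNumber-positive G H S≠∅ α))
        (flexible⇒size-bound G {ε = ε} 1≤k flexible H S≠∅ α)))

  sufficient : ε ≤ 1/ ρ → Σ ℕ λ k → (1 ℕ.≤ k) × Flexible G k ε
  sufficient ε≤1/ρ = n G ℕ.+ n G , ℕP.≤-trans (nonempty G) (ℕP.m≤m+n (n G) (n G)) ,
    size-bound⇒flexible G {ε} λ D D≠∅ α[D] →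
      Equivalence.to (*-ratio≤1⇔*-size≤ ε _ _ (independenceNumber-positive G (induced G D) D≠∅ α[D]))
        (≤-trans (*-monoˡ-≤-nonNeg ε (ratio≤ρ (induced G D) D≠∅ _ α[D]))
                 (Equivalence.to (≤1/⇔*≤1 ε ρ) ε≤1/ρ))
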